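{- Let $p \ge 3$ be a prime. There exists a solution $(x,y,z)$ for $p$ with $y = z$ if and only if $p \equiv 3 \pmod 4$. Moreover, any such solution is $(u, 2up, 2up)$ with $u = \frac{p+1}{4}$.
   Context: For a positive integer $p$, a solution for $p$ is a triple $(x,y,z)$ of positive integers with $x \le y \le z$ and $\frac{4}{p} = \frac{1}{x} + \frac{1}{y} + \frac{1}{z}$. -}

module Defs where

open import Data.Nat using (ℕ; zero; suc; _≤_; _<_)
open import Data.Integer using (+_)
open import Data.Rational using (ℚ; _/_; _+_)
import Data.Rational as ℚ
open import Data.Product using (_×_)
open import Relation.Binary.PropositionalEquality using (_≡_)

-- the rational number a / d, with the (irrelevant) convention a / 0 := 0;
-- only ever used with positive d below
frac : ℕ → ℕ → ℚ
frac a zero    = ℚ.0ℚ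
frac a (suc d) = (+ a) / suc d

IsSolution : ℕ → ℕ → ℕ → ℕ → Set
IsSolution p x y z =
  0 < x × x ≤ y × y ≤ z ×
  frac 4 p ≡ frac 1 x + frac 1 y + frac 1 z

{-# OPTIONS --safe #-}
module Submission where

-- For y = z the equation clears to 4xy = (y + 2x)p. From x ≤ y we get 4x ≤ 3p < 4p, so the
-- odd prime p does not divide 4x and must divide y = bp, leaving 4xb = bp + 2x. Then
-- d = 4x − p satisfies db = 2x, so d·2b = 4x = p + d and d divides p; d = p would make p
-- even, hence d = 1, i.e. 4x = p + 1 and y = 2xp.

open import Defs
open import Data.Nat using (ℕ; suc; zero; _≤_; _<_; _+_; _*_; _∸_; _%_; _/_; NonZero; >-nonZero; >-nonZero⁻¹; z<s)
open import Data.Nat.Properties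
open import Data.Nat.Divisibility using (_∣_; divides; divides-refl; ∣⇒≤; ∣m+n∣m⇒∣n; ∣-refl; m%n≡0⇒n∣m)
open import Data.Nat.DivMod using (m*n/n≡m; m*[n/m]≡n; [m+kn]%n≡m%n; %-distribˡ-+)
open import Data.Nat.Primality using (Prime; euclidsLemma; prime⇒irreducible; prime⇒nonZero)
open import Data.Nat.Tactic.RingSolver using (solve-∀)
import Data.Integer as ℤ
open import Data.Rational using (toℚᵘ) renaming (_+_ to _+ℚ_)
open import Data.Rational.Properties using (toℚᵘ-fromℚᵘ; toℚᵘ-injective; toℚᵘ-homo-+; toℚᵘ-cong)
open import Data.Rational.Unnormalised using (mkℚᵘ; *≡*; _≃_) renaming (_+_ to _+ᵘ_)
open import Data.Rational.Unnormalised.Properties using (≃-trans; ≃-sym; +-cong)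
open import Data.Product using (_×_; _,_; proj₁; ∃; ∃₂)
open import Data.Sum using (inj₁; inj₂; [_,_]′)
open import Function.Bundles using (_⇔_; mk⇔; Equivalence)
open import Function.Construct.Composition using (_⇔-∘_)
open import Relation.Nullary using (¬_; contradiction)
open import Relation.Binary.PropositionalEquality using (_≡_; refl; sym; trans; cong; module ≡-Reasoning)

toℚᵘ-frac : ∀ n d → toℚᵘ (frac n (suc d)) ≃ mkℚᵘ (ℤ.+ n) d
toℚᵘ-frac n d = toℚᵘ-fromℚᵘ (mkℚᵘ (ℤ.+ n) d)

toℚᵘ-sum-of-unit-fracs : ∀ x y z →
  toℚᵘ (frac 1 (suc x) +ℚ frac 1 (suc y) +ℚ frac 1 (suc z)) ≃
  mkℚᵘ (ℤ.+ 1) x +ᵘ mkℚᵘ (ℤ.+ 1) y +ᵘ mkℚᵘ (ℤ.+ 1) z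
toℚᵘ-sum-of-unit-fracs x y z =
  ≃-trans (toℚᵘ-homo-+ (frac 1 (suc x) +ℚ frac 1 (suc y)) (frac 1 (suc z)))
    (+-cong (≃-trans (toℚᵘ-homo-+ (frac 1 (suc x)) (frac 1 (suc y)))
                     (+-cong (toℚᵘ-frac 1 x) (toℚᵘ-frac 1 y)))
            (toℚᵘ-frac 1 z))

frac4≡sum⇔cleared : ∀ p x y z →
  (frac 4 (suc p) ≡ frac 1 (suc x) +ℚ frac 1 (suc y) +ℚ frac 1 (suc z)) ⇔
  (4 * (suc x * suc y * suc z) ≡ (suc y * suc z + suc x * suc z + suc x * suc y) * suc p)
frac4≡sum⇔cleared p x y z = mk⇔
  (λ eq → trans (crossMultiply (≃-trans (≃-sym (toℚᵘ-frac 4 p))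
                                  (≃-trans (toℚᵘ-cong eq) (toℚᵘ-sum-of-unit-fracs x y z))))
                (reorder (suc x) (suc y) (suc z) (suc p)))
  (λ eq → toℚᵘ-injective (≃-trans (toℚᵘ-frac 4 p)
            (≃-trans (*≡* (cong ℤ.+_ (trans eq (sym (reorder (suc x) (suc y) (suc z) (suc p))))))
                     (≃-sym (toℚᵘ-sum-of-unit-fracs x y z)))))
  where
  crossMultiply : mkℚᵘ (ℤ.+ 4) p ≃ mkℚᵘ (ℤ.+ 1) x +ᵘ mkℚᵘ (ℤ.+ 1) y +ᵘ mkℚᵘ (ℤ.+ 1) z →
    4 * (suc x * suc y * suc z) ≡ ((1 * suc y + 1 * suc x) * suc z + 1 * (suc x * suc y)) * suc p
  -- all numerators and denominators are positive, so the integer cross-multiplication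
  -- reduces to this natural-number equation
  crossMultiply (*≡* eq) = cong ℤ.∣_∣ eq
  reorder : ∀ x y z p → ((1 * y + 1 * x) * z + 1 * (x * y)) * p ≡ (y * z + x * z + x * y) * p
  reorder = solve-∀

cleared⇔twin-equation : ∀ p x y .{{_ : NonZero y}} →
  (4 * (x * y * y) ≡ (y * y + x * y + x * y) * p) ⇔ (4 * x * y ≡ (y + 2 * x) * p)
cleared⇔twin-equation p x y = mk⇔
  (λ eq → *-cancelʳ-≡ _ _ y (trans (sym (lhs x y)) (trans eq (rhs x y p))))
  (λ eq → trans (lhs x y) (trans (cong (_* y) eq) (sym (rhs x y p))))
  where
  lhs : ∀ x y → 4 * (x * y * y) ≡ 4 * x * y * y
  lhs = solve-∀
  rhs : ∀ x y p → (y * y + x * y + x * y) * p ≡ (y + 2 * x) * p * y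
  rhs = solve-∀

frac4≡sum-of-twins⇔twin-equation : ∀ p x y .{{_ : NonZero p}} .{{_ : NonZero x}} .{{_ : NonZero y}} →
  (frac 4 p ≡ frac 1 x +ℚ frac 1 y +ℚ frac 1 y) ⇔ (4 * x * y ≡ (y + 2 * x) * p)
frac4≡sum-of-twins⇔twin-equation (suc p) (suc x) (suc y) =
  cleared⇔twin-equation (suc p) (suc x) (suc y) ⇔-∘ frac4≡sum⇔cleared p x y y

excess∣ : ∀ {n d x b} → n + d ≡ 4 * x → d * b ≡ 2 * x → d ∣ n
excess∣ {n} {d} {x} {b} n+d≡4x db≡2x = ∣m+n∣m⇒∣n (divides (2 * b) (begin
  d + n         ≡⟨ +-comm d n ⟩
  n + d         ≡⟨ n+d≡4x ⟩
  4 * x         ≡⟨ *-assoc 2 2 x ⟩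
  2 * (2 * x)   ≡⟨ cong (2 *_) db≡2x ⟨
  2 * (d * b)   ≡⟨ cong (2 *_) (*-comm d b) ⟩
  2 * (b * d)   ≡⟨ *-assoc 2 b d ⟨
  2 * b * d     ∎)) ∣-refl
  where open ≡-Reasoning

twin-equation⇒4x≤3p : ∀ {p x y} → 0 < y → x ≤ y → 4 * x * y ≡ (y + 2 * x) * p → 4 * x ≤ 3 * p
twin-equation⇒4x≤3p {p} {x} {y} 0<y x≤y eq = *-cancelʳ-≤ (4 * x) (3 * p) y {{>-nonZero 0<y}} (begin
    4 * x * y         ≡⟨ eq ⟩
    (y + 2 * x) * p   ≤⟨ *-monoˡ-≤ p (+-monoʳ-≤ y (*-monoʳ-≤ 2 x≤y)) ⟩
    3 * y * p         ≡⟨ *-assoc 3 y p ⟩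
    3 * (y * p)       ≡⟨ cong (3 *_) (*-comm y p) ⟩
    3 * (p * y)       ≡⟨ *-assoc 3 p y ⟨
    3 * p * y         ∎)
  where open ≤-Reasoning

module _ {p : ℕ} (p-prime : Prime p) (3≤p : 3 ≤ p) where

  ¬2∣p : ¬ 2 ∣ p
  ¬2∣p 2∣p with prime⇒irreducible p-prime 2∣p
  ... | inj₂ refl = <⇒≱ (n<1+n 2) 3≤p

  ¬p∣2 : ¬ p ∣ 2
  ¬p∣2 p∣2 = <⇒≱ (n<1+n 2) (≤-trans 3≤p (∣⇒≤ p∣2))

  ¬p∣4 : ¬ p ∣ 4
  ¬p∣4 p∣4 = [ ¬p∣2 , ¬p∣2 ]′ (euclidsLemma 2 2 p-prime p∣4)

  ¬p∣4*m : ∀ {m} → 0 < m → m < p → ¬ p ∣ 4 * m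
  ¬p∣4*m {m} 0<m m<p p∣4*m with euclidsLemma 4 m p-prime p∣4*m
  ... | inj₁ p∣4 = ¬p∣4 p∣4
  ... | inj₂ p∣m = <⇒≱ m<p (∣⇒≤ {{>-nonZero 0<m}} p∣m)

  excess≡1 : ∀ {d x b} → p + d ≡ 4 * x → d * b ≡ 2 * x → d ≡ 1
  excess≡1 {d} {x} {b} p+d≡4x db≡2x
    with prime⇒irreducible p-prime (excess∣ {p} {d} {x} {b} p+d≡4x db≡2x)
  ... | inj₁ d≡1 = d≡1
  ... | inj₂ refl = contradiction (divides x p≡x*2) ¬2∣p
    where
    p≡x*2 : p ≡ x * 2
    p≡x*2 = *-cancelˡ-≡ p (x * 2) 2 (begin
      2 * p         ≡⟨ cong (p +_) (+-identityʳ p) ⟩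
      p + p         ≡⟨ p+d≡4x ⟩
      4 * x         ≡⟨ *-assoc 2 2 x ⟩
      2 * (2 * x)   ≡⟨ cong (2 *_) (*-comm 2 x) ⟩
      2 * (x * 2)   ∎)
      where open ≡-Reasoning

  private instance
    p-nonZero : NonZero p
    p-nonZero = prime⇒nonZero p-prime

  quotient-equation⇒ : ∀ {x b} → 0 < x → 4 * x * b ≡ b * p + 2 * x → 4 * x ≡ p + 1 × b ≡ 2 * x
  quotient-equation⇒ {x} {b} 0<x eq = trans (sym p+d≡4x) (cong (p +_) d≡1) , (begin
      b       ≡⟨ *-identityˡ b ⟨
      1 * b   ≡⟨ cong (_* b) d≡1 ⟨
      d * b   ≡⟨ db≡2x ⟩
      2 * x   ∎)
    where
    open ≡-Reasoning
    p≤4x : p ≤ 4 * x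
    p≤4x = ≮⇒≥ λ 4x<p → <-irrefl eq (≤-<-trans
      (≤-trans (*-monoˡ-≤ b (<⇒≤ 4x<p)) (≤-reflexive (*-comm p b)))
      (m<m+n (b * p) (≤-trans 0<x (m≤m+n x (1 * x)))))
    d : ℕ
    d = 4 * x ∸ p
    p+d≡4x : p + d ≡ 4 * x
    p+d≡4x = m+[n∸m]≡n p≤4x
    db≡2x : d * b ≡ 2 * x
    db≡2x = +-cancelˡ-≡ (b * p) (d * b) (2 * x) (begin
      b * p + d * b   ≡⟨ cong (_+ d * b) (*-comm b p) ⟩
      p * b + d * b   ≡⟨ *-distribʳ-+ b p d ⟨
      (p + d) * b     ≡⟨ cong (_* b) p+d≡4x ⟩
      4 * x * b       ≡⟨ eq ⟩
      b * p + 2 * x   ∎)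
    d≡1 : d ≡ 1
    d≡1 = excess≡1 {d} {x} {b} p+d≡4x db≡2x

  twin-equation⇒p∣y : ∀ {x y} → 0 < x → x ≤ y → 4 * x * y ≡ (y + 2 * x) * p → p ∣ y
  twin-equation⇒p∣y {x} {y} 0<x x≤y eq with euclidsLemma (4 * x) y p-prime (divides (y + 2 * x) eq)
  ... | inj₁ p∣4x = contradiction p∣4x (¬p∣4*m 0<x x<p)
    where
    x<p : x < p
    x<p = ≰⇒> λ p≤x → <⇒≱ (m<n+m (3 * p) (>-nonZero⁻¹ p))
      (≤-trans (*-monoʳ-≤ 4 p≤x) (twin-equation⇒4x≤3p {p} {x} {y} (<-≤-trans 0<x x≤y) x≤y eq))
  ... | inj₂ p∣y = p∣y

  twin-equation⇒ : ∀ {x y} → 0 < x → x ≤ y → 4 * x * y ≡ (y + 2 * x) * p →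
    4 * x ≡ p + 1 × y ≡ 2 * x * p
  twin-equation⇒ {x} 0<x x≤y eq = multiple-of-p eq (twin-equation⇒p∣y 0<x x≤y eq)
    where
    multiple-of-p : ∀ {y} → 4 * x * y ≡ (y + 2 * x) * p → p ∣ y → 4 * x ≡ p + 1 × y ≡ 2 * x * p
    multiple-of-p eq (divides-refl b)
      with quotient-equation⇒ 0<x (*-cancelʳ-≡ (4 * x * b) (b * p + 2 * x) p (trans (*-assoc (4 * x) b p) eq))
    ... | 4x≡p+1 , b≡2x = 4x≡p+1 , cong (_* p) b≡2x

  twin-solution⇒ : ∀ {x y} → IsSolution p x y y → 4 * x ≡ p + 1 × y ≡ 2 * x * p
  twin-solution⇒ {x} {y} (0<x , x≤y , _ , eq) = twin-equation⇒ 0<x x≤y (Equivalence.to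
    (frac4≡sum-of-twins⇔twin-equation p x y {{p-nonZero}} {{>-nonZero 0<x}} {{>-nonZero 0<y}}) eq)
    where
    0<y : 0 < y
    0<y = <-≤-trans 0<x x≤y

4*x≡n+1⇒x≡1+k∧n≡3+k*4 : ∀ {x n} → 4 * x ≡ n + 1 → ∃ λ k → x ≡ suc k × n ≡ 3 + k * 4
4*x≡n+1⇒x≡1+k∧n≡3+k*4 {zero} {n} eq with trans eq (+-comm n 1)
... | ()
4*x≡n+1⇒x≡1+k∧n≡3+k*4 {suc k} {n} eq = k , refl , +-cancelʳ-≡ 1 n (3 + k * 4) (trans (sym eq) (4[1+k]≡3+k*4+1 k))
  where
  4[1+k]≡3+k*4+1 : ∀ k → 4 * suc k ≡ 3 + k * 4 + 1
  4[1+k]≡3+k*4+1 = solve-∀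

4*x≡n+1⇒n%4≡3 : ∀ {x n} → 4 * x ≡ n + 1 → n % 4 ≡ 3
4*x≡n+1⇒n%4≡3 {x} {n} eq with 4*x≡n+1⇒x≡1+k∧n≡3+k*4 {x} {n} eq
... | k , _ , refl = [m+kn]%n≡m%n 3 k 4

n%4≡3⇒4*[[n+1]/4]≡n+1 : ∀ {n} → n % 4 ≡ 3 → 4 * ((n + 1) / 4) ≡ n + 1
n%4≡3⇒4*[[n+1]/4]≡n+1 {n} eq =
  m*[n/m]≡n (m%n≡0⇒n∣m (n + 1) 4 (trans (%-distribˡ-+ n 1 4) (cong (λ r → (r + 1 % 4) % 4) eq)))

4*m≡n⇒m≡n/4 : ∀ {m n} → 4 * m ≡ n → m ≡ n / 4
4*m≡n⇒m≡n/4 {m} eq = trans (sym (m*n/n≡m m 4)) (cong (_/ 4) (trans (*-comm m 4) eq))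

twin-equation⇐ : ∀ {p x} → 4 * x ≡ p + 1 → 4 * x * (2 * x * p) ≡ (2 * x * p + 2 * x) * p
twin-equation⇐ {p} {x} eq = begin
  4 * x * (2 * x * p)       ≡⟨ lhs x p ⟩
  2 * x * p * (4 * x)       ≡⟨ cong (2 * x * p *_) eq ⟩
  2 * x * p * (p + 1)       ≡⟨ rhs x p ⟩
  (2 * x * p + 2 * x) * p   ∎
  where
  open ≡-Reasoning
  lhs : ∀ x p → 4 * x * (2 * x * p) ≡ 2 * x * p * (4 * x)
  lhs = solve-∀
  rhs : ∀ x p → 2 * x * p * (p + 1) ≡ (2 * x * p + 2 * x) * p
  rhs = solve-∀

twin-solution : ∀ {p x} → 4 * x ≡ p + 1 → IsSolution p x (2 * x * p) (2 * x * p)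
twin-solution {p} {x} eq with 4*x≡n+1⇒x≡1+k∧n≡3+k*4 {x} {p} eq
... | k , refl , refl =
  z<s , ≤-trans (m≤n*m (suc k) 2) (m≤m*n (2 * suc k) (3 + k * 4)) , ≤-refl ,
  Equivalence.from (frac4≡sum-of-twins⇔twin-equation (3 + k * 4) (suc k) (2 * suc k * (3 + k * 4)))
    (twin-equation⇐ {3 + k * 4} {suc k} eq)

mainTheorem5 : ∀ (p : ℕ) → Prime p → 3 ≤ p →
    ((∃₂ λ x y → IsSolution p x y y) ⇔ (p % 4 ≡ 3))
    × (∀ x y z → IsSolution p x y z → y ≡ z →
        x ≡ (p + 1) / 4 × y ≡ 2 * ((p + 1) / 4) * p × z ≡ 2 * ((p + 1) / 4) * p)
mainTheorem5 p p-prime 3≤p =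
  mk⇔ (λ (x , y , sol) → 4*x≡n+1⇒n%4≡3 {x} {p} (proj₁ (twin-solution⇒ p-prime 3≤p {x} {y} sol)))
      (λ p%4≡3 → _ , _ , twin-solution {p} {(p + 1) / 4} (n%4≡3⇒4*[[n+1]/4]≡n+1 p%4≡3)) ,
  λ { x y .y sol refl → closed-form {x} {y} (twin-solution⇒ p-prime 3≤p sol) }
  where
  closed-form : ∀ {x y} → 4 * x ≡ p + 1 × y ≡ 2 * x * p →
    x ≡ (p + 1) / 4 × y ≡ 2 * ((p + 1) / 4) * p × y ≡ 2 * ((p + 1) / 4) * p
  closed-form {x} {y} (4x≡p+1 , y≡2xp) = x≡[p+1]/4 , y≡2up , y≡2up
    where
    x≡[p+1]/4 : x ≡ (p + 1) / 4
    x≡[p+1]/4 = 4*m≡n⇒m≡n/4 4x≡p+1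
    y≡2up : y ≡ 2 * ((p + 1) / 4) * p
    y≡2up = trans y≡2xp (cong (λ u → 2 * u * p) x≡[p+1]/4)
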